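{- For every integer $k\geq 2$ there exists a finite, simple, connected graph of order $3k$ which has metric dimension $k$ and exactly one metric basis.
   Context: For vertices $u,v$ of a connected graph $G$, $d(u,v)$ is the distance between them. For an ordered set $W=\{w_1,\dots,w_k\}\subseteq V(G)$ and $v\in V(G)$, $r(v|W)=(d(v,w_1),\dots,d(v,w_k))$. $W$ is a resolving set if distinct vertices have distinct representations $r(\cdot|W)$. A resolving set of minimum cardinality is a metric basis; its cardinality is the metric dimension $\beta(G)$. -}

module Defs where

open import Data.Nat using (ℕ; zero; suc; _≤_)
open import Data.Fin using (Fin)
open import Data.Fin.Subset using (Subset; _∈_; ∣_∣)
open import Data.Bool using (Bool; true; false)
open import Data.Product using (Σ; _×_; ∃)
open import Relation.Binary.PropositionalEquality using (_≡_)
open import Relation.Nullary using (¬_)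

record Graph (n : ℕ) : Set where
  field
    adj     : Fin n → Fin n → Bool
    sym     : ∀ u v → adj u v ≡ adj v u
    irrefl  : ∀ v → adj v v ≡ false

open Graph public

data Walk {n : ℕ} (G : Graph n) : Fin n → Fin n → ℕ → Set where
  here : ∀ {v} → Walk G v v zero
  step : ∀ {u v w m} → adj G u v ≡ true → Walk G v w m → Walk G u w (suc m)

Dist : {n : ℕ} → Graph n → Fin n → Fin n → ℕ → Set
Dist G u v m = Walk G u v m × (∀ l → Walk G u v l → m ≤ l)

Connected : {n : ℕ} → Graph n → Set
Connected G = ∀ u v → ∃ λ m → Walk G u v m

-- W is resolving: vertices with the same distance vector to W are equal.
-- (Distances exist and are unique in a connected graph, so "same
--  representation" means: for each w ∈ W and each m, d(x,w)=m iff d(y,w)=m.)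
SameRep : {n : ℕ} → Graph n → Subset n → Fin n → Fin n → Set
SameRep G W x y = ∀ w → w ∈ W → ∀ m → (Dist G x w m → Dist G y w m) × (Dist G y w m → Dist G x w m)

Resolving : {n : ℕ} → Graph n → Subset n → Set
Resolving G W = ∀ x y → SameRep G W x y → x ≡ y

MetricBasis : {n : ℕ} → Graph n → Subset n → Set
MetricBasis G W = Resolving G W × (∀ W′ → Resolving G W′ → ∣ W ∣ ≤ ∣ W′ ∣)

MetricDimension : {n : ℕ} → Graph n → ℕ → Set
MetricDimension G k = ∃ λ W → MetricBasis G W × ∣ W ∣ ≡ k

UniqueBasis : {n : ℕ} → Graph n → Set
UniqueBasis G = ∃ λ W → MetricBasis G W × (∀ W′ → MetricBasis G W′ → W′ ≡ W)

module Submission where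

-- The graph: an independent set {0, …, k−1} and a clique c₀, …, c₂ₖ₋₁, where a is adjacent to the
-- window c_{a+1}, …, c_{a+k}. The clique vertex c_k is adjacent to everything, so distances are 0, 1
-- or 2, and two vertices outside W have the same representation iff they have the same
-- neighbours in W.
-- The independent set resolves, since different clique vertices have different windows.
-- Conversely, read the clique cyclically: c_t and c_{t+1} are seen alike by every independent
-- vertex except t mod k, so a resolving W contains c_t, c_{t+1} or t mod k. Summing over the 2k
-- cyclic pairs counts every element of W twice, whence |W| ≥ k. If |W| = k every pair is covered
-- exactly once; a clique vertex in W would then cover both pairs it lies in alone, leaving its two
-- cyclic neighbours unseparated. So W avoids the clique and is the independent set.

open import Defs renaming (sym to adj-sym)
open import Data.Bool using (Bool; true; false)
open import Data.Empty using (⊥)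
import Data.Fin as Fin
open import Data.Fin using (Fin; toℕ; fromℕ<; _≟_)
open import Data.Fin.Properties using (toℕ-injective; toℕ<n; toℕ-fromℕ<)
open import Data.Fin.Subset using (Subset; _∈_; ∣_∣)
import Data.Nat as ℕ
open import Data.Nat
  using (ℕ; zero; suc; _+_; _*_; _∸_; _≤_; _<_; _≤?_; _<?_; z≤n; s≤s; z<s; s<s; s≤s⁻¹; NonZero; >-nonZero)
open import Data.Nat.DivMod using (_%_; m%n<n; m<n⇒m%n≡m; n%n≡0; [m+n]%n≡m%n)
open import Data.Nat.Properties hiding (_≟_)
open import Algebra.Properties.CommutativeSemigroup +-commutativeSemigroup using (interchange)
open import Data.Product using (Σ; Σ-syntax; _×_; _,_; proj₁; proj₂; swap)
open import Data.Sum using (inj₁; inj₂)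
open import Data.Vec using ([]; _∷_; lookup; tabulate)
open import Data.Vec.Properties using ([]=⇒lookup; lookup⇒[]=; lookup∘tabulate)
open import Function using (_∘_)
open import Function.Bundles using (_⇔_; mk⇔)
open import Relation.Binary.Definitions using (tri<; tri≈; tri>)
open import Relation.Binary.PropositionalEquality
open import Relation.Nullary using (¬_; Dec; does; yes; no; contradiction)
open import Relation.Nullary.Decidable using (dec-true; dec-false; does-⇔; _×-dec_; ¬?)

private variable
  m n : ℕ

∑< : ℕ → (ℕ → ℕ) → ℕ
∑< zero    f = 0
∑< (suc n) f = ∑< n f + f n

∑<-cong : ∀ n {f g : ℕ → ℕ} → (∀ i → i < n → f i ≡ g i) → ∑< n f ≡ ∑< n g
∑<-cong zero    f≗g = refl
∑<-cong (suc n) f≗g = cong₂ _+_ (∑<-cong n (λ i i<n → f≗g i (m<n⇒m<1+n i<n))) (f≗g n ≤-refl)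

∑<-distrib-+ : ∀ n (f g : ℕ → ℕ) → ∑< n (λ i → f i + g i) ≡ ∑< n f + ∑< n g
∑<-distrib-+ zero    f g = refl
∑<-distrib-+ (suc n) f g =
  trans (cong (_+ (f n + g n)) (∑<-distrib-+ n f g)) (interchange (∑< n f) (∑< n g) (f n) (g n))

∑<-head : ∀ n (f : ℕ → ℕ) → ∑< (suc n) f ≡ f 0 + ∑< n (λ i → f (suc i))
∑<-head zero    f = +-comm 0 (f 0)
∑<-head (suc n) f = trans (cong (_+ f (suc n)) (∑<-head n f)) (+-assoc (f 0) _ _)

∑<-split : ∀ m n (f : ℕ → ℕ) → ∑< (m + n) f ≡ ∑< m f + ∑< n (λ i → f (m + i))
∑<-split m zero    f = trans (cong (λ l → ∑< l f) (+-identityʳ m)) (sym (+-identityʳ _))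
∑<-split m (suc n) f = begin
  ∑< (m + suc n) f                           ≡⟨ cong (λ l → ∑< l f) (+-suc m n) ⟩
  ∑< (m + n) f + f (m + n)                   ≡⟨ cong (_+ f (m + n)) (∑<-split m n f) ⟩
  ∑< m f + ∑< n (λ i → f (m + i)) + f (m + n) ≡⟨ +-assoc (∑< m f) _ _ ⟩
  ∑< m f + ∑< (suc n) (λ i → f (m + i))      ∎
  where open ≡-Reasoning

∑<-rotate : ∀ n .{{_ : NonZero n}} (f : ℕ → ℕ) → ∑< n (λ i → f (suc i % n)) ≡ ∑< n f
∑<-rotate (suc n) f = begin
  ∑< n (λ i → f (suc i % suc n)) + f (suc n % suc n)
    ≡⟨ cong₂ _+_ (∑<-cong n (λ i i<n → cong f (m<n⇒m%n≡m (s<s i<n)))) (cong f (n%n≡0 (suc n))) ⟩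
  ∑< n (λ i → f (suc i)) + f 0                       ≡⟨ +-comm _ (f 0) ⟩
  f 0 + ∑< n (λ i → f (suc i))                       ≡⟨ ∑<-head n f ⟨
  ∑< (suc n) f                                       ∎
  where open ≡-Reasoning

∑<-mod-double : ∀ n .{{_ : NonZero n}} (f : ℕ → ℕ) → ∑< (n + n) (λ i → f (i % n)) ≡ ∑< n f + ∑< n f
∑<-mod-double n f = trans (∑<-split n n _) (cong₂ _+_ (∑<-cong n (λ i i<n → cong f (m<n⇒m%n≡m i<n)))
                                                      (∑<-cong n (λ i i<n → cong f (shift i i<n))))
  where
  shift : ∀ i → i < n → (n + i) % n ≡ i
  shift i i<n = trans (cong (_% n) (+-comm n i)) (trans ([m+n]%n≡m%n i n) (m<n⇒m%n≡m i<n))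

∑<-const : ∀ n c → ∑< n (λ _ → c) ≡ n * c
∑<-const zero    c = refl
∑<-const (suc n) c = trans (cong (_+ c) (∑<-const n c)) (+-comm (n * c) c)

∑<-ones : ∀ n → ∑< n (λ _ → 1) ≡ n
∑<-ones n = trans (∑<-const n 1) (*-identityʳ n)

∑<-zeros : ∀ n → ∑< n (λ _ → 0) ≡ 0
∑<-zeros n = trans (∑<-const n 0) (*-zeroʳ n)

∑<-mono-≤ : ∀ n {f g : ℕ → ℕ} → (∀ i → i < n → f i ≤ g i) → ∑< n f ≤ ∑< n g
∑<-mono-≤ zero    f≤g = z≤n
∑<-mono-≤ (suc n) f≤g = +-mono-≤ (∑<-mono-≤ n (λ i i<n → f≤g i (m<n⇒m<1+n i<n))) (f≤g n ≤-refl)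

∑<-mono-≤-tight : ∀ n {f g : ℕ → ℕ} → (∀ i → i < n → f i ≤ g i) → ∑< n g ≤ ∑< n f →
                  ∀ i → i < n → f i ≡ g i
∑<-mono-≤-tight (suc n) {f} {g} f≤g ∑g≤∑f i i<1+n with m≤n⇒m<n∨m≡n (s≤s⁻¹ i<1+n)
... | inj₁ i<n  = ∑<-mono-≤-tight n (λ j j<n → f≤g j (m<n⇒m<1+n j<n)) ∑ₙg≤∑ₙf i i<n
  where
  ∑ₙg≤∑ₙf : ∑< n g ≤ ∑< n f
  ∑ₙg≤∑ₙf = +-cancelʳ-≤ (g n) _ _ (≤-trans ∑g≤∑f (+-monoʳ-≤ (∑< n f) (f≤g n ≤-refl)))
... | inj₂ refl =
  ≤-antisym (f≤g n ≤-refl) (+-cancelˡ-≤ (∑< n g) _ _ (≤-trans ∑g≤∑f (+-monoˡ-≤ (f n) ∑ₙf≤∑ₙg)))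
  where
  ∑ₙf≤∑ₙg : ∑< n f ≤ ∑< n g
  ∑ₙf≤∑ₙg = ∑<-mono-≤ n (λ j j<n → f≤g j (m<n⇒m<1+n j<n))

bit : Bool → ℕ
bit false = 0
bit true  = 1

bit-injective : ∀ {x y} → bit x ≡ bit y → x ≡ y
bit-injective {false} {false} _ = refl
bit-injective {true}  {true}  _ = refl

-- Indexed by ℕ rather than Fin n (with value 0 beyond n) so that it can be summed with ∑<.
χ : Subset n → ℕ → ℕ
χ []      _       = 0
χ (x ∷ p) zero    = bit x
χ (x ∷ p) (suc m) = χ p m

χ≤1 : ∀ (p : Subset n) m → χ p m ≤ 1
χ≤1 []            _       = z≤n
χ≤1 (false ∷ p)   zero    = z≤n
χ≤1 (true ∷ p)    zero    = ≤-refl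
χ≤1 (x ∷ p)       (suc m) = χ≤1 p m

χ-lookup : ∀ (p : Subset n) v → χ p (toℕ v) ≡ bit (lookup p v)
χ-lookup (x ∷ p) Fin.zero    = refl
χ-lookup (x ∷ p) (Fin.suc v) = χ-lookup p v

χ-∈ : ∀ {p : Subset n} {v} → v ∈ p → χ p (toℕ v) ≡ 1
χ-∈ {p = p} v∈p = trans (χ-lookup p _) (cong bit ([]=⇒lookup v∈p))

∣p∣≡∑χ : ∀ (p : Subset n) → ∣ p ∣ ≡ ∑< n (χ p)
∣p∣≡∑χ []                    = refl
∣p∣≡∑χ {suc n} (true ∷ p)  = trans (cong suc (∣p∣≡∑χ p)) (sym (∑<-head n (χ (true ∷ p))))
∣p∣≡∑χ {suc n} (false ∷ p) = trans (∣p∣≡∑χ p) (sym (∑<-head n (χ (false ∷ p))))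

χ-injective : ∀ (p q : Subset n) → (∀ m → m < n → χ p m ≡ χ q m) → p ≡ q
χ-injective []      []      _    = refl
χ-injective (x ∷ p) (y ∷ q) χ≗χ =
  cong₂ _∷_ (bit-injective (χ≗χ 0 z<s)) (χ-injective p q (λ m m<n → χ≗χ (suc m) (s<s m<n)))

χ-tabulate : ∀ (f : ℕ → Bool) m → m < n → χ (tabulate {n = n} (λ v → f (toℕ v))) m ≡ bit (f m)
χ-tabulate {suc n} f zero    _         = refl
χ-tabulate {suc n} f (suc m) (s<s m<n) = χ-tabulate (λ i → f (suc i)) m m<n

≢-by-χ : ∀ {p : Subset n} {m m′} → χ p m ≡ 1 → χ p m′ ≡ 0 → m ≢ m′
≢-by-χ χm≡1 χm′≡0 refl = contradiction (trans (sym χm≡1) χm′≡0) λ ()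

x+1+z≡1⇒ : ∀ x z → x + 1 + z ≡ 1 → x ≡ 0 × z ≡ 0
x+1+z≡1⇒ zero    z eq = refl , suc-injective eq
x+1+z≡1⇒ (suc x) z eq = contradiction (m+n≡0⇒n≡0 x (m+n≡0⇒m≡0 (x + 1) (suc-injective eq))) λ ()

1+y+z≡1⇒ : ∀ y z → 1 + y + z ≡ 1 → y ≡ 0 × z ≡ 0
1+y+z≡1⇒ y z eq = m+n≡0⇒m≡0 y (suc-injective eq) , m+n≡0⇒n≡0 y (suc-injective eq)

suc-%-≢ : ∀ n .{{_ : NonZero n}} {t} → 1 < n → t < n → suc t % n ≢ t
suc-%-≢ n {t} 1<n t<n eq with m≤n⇒m<n∨m≡n t<n
... | inj₁ 1+t<n = 1+n≢n (trans (sym (m<n⇒m%n≡m 1+t<n)) eq)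
... | inj₂ 1+t≡n = <-irrefl (trans (cong suc 0≡t) 1+t≡n) 1<n
  where
  0≡t : 0 ≡ t
  0≡t = trans (sym (trans (cong (_% n) 1+t≡n) (n%n≡0 n))) eq

suc-%-suc-%-≢ : ∀ n .{{_ : NonZero n}} {t} → 2 < n → t < n → suc (suc t % n) % n ≢ t
suc-%-suc-%-≢ n {t} 2<n t<n eq with m≤n⇒m<n∨m≡n t<n
... | inj₂ 1+t≡n = <-irrefl (trans (cong suc 1≡t) 1+t≡n) 2<n
  where
  1≡t : 1 ≡ t
  1≡t = begin
    1                   ≡⟨ m<n⇒m%n≡m (<-trans (s<s z<s) 2<n) ⟨
    1 % n               ≡⟨ cong (λ r → suc r % n) (trans (cong (_% n) 1+t≡n) (n%n≡0 n)) ⟨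
    suc (suc t % n) % n ≡⟨ eq ⟩
    t                   ∎
    where open ≡-Reasoning
... | inj₁ 1+t<n with m≤n⇒m<n∨m≡n 1+t<n
...   | inj₁ 2+t<n = <-irrefl (sym (trans (sym (m<n⇒m%n≡m 2+t<n)) eq′)) (m<n⇒m<1+n (n<1+n t))
  where
  eq′ : suc (suc t) % n ≡ t
  eq′ = trans (cong (λ r → suc r % n) (sym (m<n⇒m%n≡m 1+t<n))) eq
...   | inj₂ 2+t≡n = <-irrefl (trans (cong (suc ∘ suc) 0≡t) 2+t≡n) 2<n
  where
  0≡t : 0 ≡ t
  0≡t = begin
    0                   ≡⟨ n%n≡0 n ⟨
    n % n               ≡⟨ cong (_% n) 2+t≡n ⟨
    suc (suc t) % n     ≡⟨ cong (λ r → suc r % n) (m<n⇒m%n≡m 1+t<n) ⟨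
    suc (suc t % n) % n ≡⟨ eq ⟩
    t                   ∎
    where open ≡-Reasoning

module WithUniversalVertex {n} (G : Graph n) (hub : Fin n)
                           (hub-adj : ∀ u → u ≢ hub → adj G u hub ≡ true) where

  private variable
    u v w x y : Fin n
    W : Subset n

  distance : Bool → Bool → ℕ
  distance true  _     = 0
  distance false true  = 1
  distance false false = 2

  dist : Fin n → Fin n → ℕ
  dist u v = distance (does (u ≟ v)) (adj G u v)

  dist-walk : ∀ u v → Walk G u v (dist u v)
  dist-walk u v with u ≟ v | adj G u v in u~v
  ... | yes refl | _     = here
  ... | no u≢v   | true  = step u~v here
  ... | no u≢v   | false = step (hub-adj u u≢hub) (step (trans (adj-sym G hub v) (hub-adj v v≢hub)) here)
    where
    u≢hub : u ≢ hub
    u≢hub refl =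
      contradiction (trans (sym (trans (adj-sym G hub v) (hub-adj v (λ v≡hub → u≢v (sym v≡hub))))) u~v) λ ()
    v≢hub : v ≢ hub
    v≢hub refl = contradiction (trans (sym (hub-adj u u≢v)) u~v) λ ()

  walk-length≥1 : ∀ {l} → u ≢ v → Walk G u v l → 1 ≤ l
  walk-length≥1 u≢v here       = contradiction refl u≢v
  walk-length≥1 _   (step _ _) = s≤s z≤n

  walk-length≥2 : ∀ {l} → u ≢ v → adj G u v ≡ false → Walk G u v l → 2 ≤ l
  walk-length≥2 u≢v _   here                = contradiction refl u≢v
  walk-length≥2 _   u≁v (step u~v here)     = contradiction (trans (sym u~v) u≁v) λ ()
  walk-length≥2 _   _   (step _ (step _ _)) = s≤s (s≤s z≤n)

  dist-minimal : ∀ u v l → Walk G u v l → dist u v ≤ l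
  dist-minimal u v l walk with u ≟ v | adj G u v in u~v
  ... | yes _  | _     = z≤n
  ... | no u≢v | true  = walk-length≥1 u≢v walk
  ... | no u≢v | false = walk-length≥2 u≢v u~v walk

  dist-Dist : ∀ u v → Dist G u v (dist u v)
  dist-Dist u v = dist-walk u v , dist-minimal u v

  Dist⇒≡dist : ∀ {m} → Dist G u v m → m ≡ dist u v
  Dist⇒≡dist {u} {v} (walk , minimal) = ≤-antisym (minimal _ (dist-walk u v)) (dist-minimal u v _ walk)

  connected : Connected G
  connected u v = dist u v , dist-walk u v

  dist-self : dist v v ≡ 0
  dist-self {v} = cong (λ b → distance b (adj G v v)) (dec-true (v ≟ v) refl)

  dist-≢ : u ≢ v → dist u v ≡ distance false (adj G u v)
  dist-≢ {u} {v} u≢v = cong (λ b → distance b (adj G u v)) (dec-false (u ≟ v) u≢v)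

  dist≡0⇒≡ : dist u v ≡ 0 → u ≡ v
  dist≡0⇒≡ {u} {v} d≡0 with u ≟ v | adj G u v
  ... | yes u≡v | _     = u≡v
  ... | no _    | true  = contradiction d≡0 λ ()
  ... | no _    | false = contradiction d≡0 λ ()

  distance-false-injective : ∀ {b c} → distance false b ≡ distance false c → b ≡ c
  distance-false-injective {true}  {true}  _ = refl
  distance-false-injective {false} {false} _ = refl

  sameRep⇒dist≡ : SameRep G W x y → w ∈ W → dist x w ≡ dist y w
  sameRep⇒dist≡ {x = x} {w = w} x≈y w∈W = Dist⇒≡dist (proj₁ (x≈y w w∈W (dist x w)) (dist-Dist x w))

  dist≡⇒sameRep : (∀ w → w ∈ W → dist x w ≡ dist y w) → SameRep G W x y
  dist≡⇒sameRep {x = x} {y} d≡d w w∈W m =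
    (λ d → subst (Dist G y w) (sym (trans (Dist⇒≡dist d) (d≡d w w∈W))) (dist-Dist y w)) ,
    (λ d → subst (Dist G x w) (sym (trans (Dist⇒≡dist d) (sym (d≡d w w∈W)))) (dist-Dist x w))

  sameRep-∈ : SameRep G W x y → x ∈ W → x ≡ y
  sameRep-∈ {x = x} {y} x≈y x∈W = sym (dist≡0⇒≡ (trans (sym (sameRep⇒dist≡ x≈y x∈W)) dist-self))

  sameRep⇒adj≡ : SameRep G W x y → w ∈ W → x ≢ w → y ≢ w → adj G x w ≡ adj G y w
  sameRep⇒adj≡ x≈y w∈W x≢w y≢w =
    distance-false-injective (trans (sym (dist-≢ x≢w)) (trans (sameRep⇒dist≡ x≈y w∈W) (dist-≢ y≢w)))

  adj≡⇒sameRep : (∀ w → w ∈ W → x ≢ w × y ≢ w × adj G x w ≡ adj G y w) → SameRep G W x y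
  adj≡⇒sameRep agree = dist≡⇒sameRep λ w w∈W → let (x≢w , y≢w , x~w≡y~w) = agree w w∈W in
    trans (dist-≢ x≢w) (trans (cong (distance false) x~w≡y~w) (sym (dist-≢ y≢w)))

  sameRep-sym : SameRep G W x y → SameRep G W y x
  sameRep-sym x≈y w w∈W m = swap (x≈y w w∈W m)

module Construction (k : ℕ) (2≤k : 2 ≤ k) where

  0<k : 0 < k
  0<k = <-trans z<s 2≤k

  2<k+k : 2 < k + k
  2<k+k = <-≤-trans (s<s (s<s z<s)) (+-mono-≤ 2≤k 2≤k)

  instance
    k-nonZero : NonZero k
    k-nonZero = >-nonZero 0<k

    k+k-nonZero : NonZero (k + k)
    k+k-nonZero = >-nonZero (<-trans z<s 2<k+k)

  private variable
    a s t : ℕ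
    W : Subset (3 * k)

  Window : ℕ → ℕ → Set
  Window a t = a < t × t ≤ a + k

  window? : ∀ a t → Dec (Window a t)
  window? a t = (a <? t) ×-dec (t ≤? a + k)

  sees : ℕ → ℕ → Bool
  sees a t = does (window? a t)

  data Role : Set where
    indep clique : ℕ → Role

  Adjacent : Role → Role → Set
  Adjacent (indep _)  (indep _)  = ⊥
  Adjacent (indep a)  (clique t) = Window a t
  Adjacent (clique t) (indep a)  = Window a t
  Adjacent (clique s) (clique t) = s ≢ t

  adjacent? : ∀ r r′ → Dec (Adjacent r r′)
  adjacent? (indep _)  (indep _)  = no λ ()
  adjacent? (indep a)  (clique t) = window? a t
  adjacent? (clique t) (indep a)  = window? a t
  adjacent? (clique s) (clique t) = ¬? (s ℕ.≟ t)

  adjacent-sym : ∀ r r′ → Adjacent r r′ → Adjacent r′ r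
  adjacent-sym (indep _)  (clique _) w   = w
  adjacent-sym (clique _) (indep _)  w   = w
  adjacent-sym (clique _) (clique _) s≢t = s≢t ∘ sym

  adjacent?-sym : ∀ r r′ → does (adjacent? r r′) ≡ does (adjacent? r′ r)
  adjacent?-sym r r′ = does-⇔ (mk⇔ (adjacent-sym r r′) (adjacent-sym r′ r)) (adjacent? r r′) (adjacent? r′ r)

  adjacent-irrefl : ∀ r → ¬ Adjacent r r
  adjacent-irrefl (indep _)  ()
  adjacent-irrefl (clique _) t≢t = t≢t refl

  -- Vertices 0, …, k − 1 form the independent set and vertex k + t is the clique vertex c_t.
  role : ℕ → Role
  role m with m <? k
  ... | yes _ = indep m
  ... | no  _ = clique (m ∸ k)

  role-indep : a < k → role a ≡ indep a
  role-indep {a} a<k with a <? k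
  ... | yes _   = refl
  ... | no  a≮k = contradiction a<k a≮k

  role-clique : ∀ t → role (k + t) ≡ clique t
  role-clique t with k + t <? k
  ... | yes k+t<k = contradiction k+t<k (m+n≮m k t)
  ... | no  _     = cong clique (m+n∸m≡n k t)

  G : Graph (3 * k)
  G = record
    { adj    = λ u v → does (adjacent? (role (toℕ u)) (role (toℕ v)))
    ; sym    = λ u v → adjacent?-sym (role (toℕ u)) (role (toℕ v))
    ; irrefl = λ v → dec-false (adjacent? (role (toℕ v)) (role (toℕ v))) (adjacent-irrefl (role (toℕ v)))
    }

  adj-roles : ∀ {u v r r′} → role (toℕ u) ≡ r → role (toℕ v) ≡ r′ → adj G u v ≡ does (adjacent? r r′)
  adj-roles = cong₂ (λ r r′ → does (adjacent? r r′))

  3k≡k+2k : 3 * k ≡ k + (k + k)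
  3k≡k+2k = cong (λ n → k + (k + n)) (+-identityʳ k)

  indep<3k : a < k → a < 3 * k
  indep<3k a<k = ≤-trans a<k (m≤m+n k _)

  clique<3k : t < k + k → k + t < 3 * k
  clique<3k {t} t<2k = subst (k + t <_) (sym 3k≡k+2k) (+-monoʳ-< k t<2k)

  data Label (m : ℕ) : Set where
    indep  : m < k → Label m
    clique : ∀ {t} → t < k + k → m ≡ k + t → Label m

  label : ∀ m → m < 3 * k → Label m
  label m m<3k with m <? k
  ... | yes m<k = indep m<k
  ... | no  m≮k = clique (+-cancelˡ-< k _ _ (subst₂ _<_ m≡k+t 3k≡k+2k m<3k)) m≡k+t
    where
    m≡k+t : m ≡ k + (m ∸ k)
    m≡k+t = sym (m+[n∸m]≡n (≮⇒≥ m≮k))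

  cliqueV : ∀ t → t < k + k → Fin (3 * k)
  cliqueV t t<2k = fromℕ< (clique<3k t<2k)

  toℕ-cliqueV : ∀ (t<2k : t < k + k) → toℕ (cliqueV t t<2k) ≡ k + t
  toℕ-cliqueV _ = toℕ-fromℕ< _

  role-cliqueV : ∀ (t<2k : t < k + k) → role (toℕ (cliqueV t t<2k)) ≡ clique t
  role-cliqueV {t} t<2k = trans (cong role (toℕ-cliqueV t<2k)) (role-clique t)

  k<k+k : k < k + k
  k<k+k = m<m+n k 0<k

  hub : Fin (3 * k)
  hub = cliqueV k k<k+k

  hub-adj : ∀ u → u ≢ hub → adj G u hub ≡ true
  hub-adj u u≢hub with label (toℕ u) (toℕ<n u)
  ... | indep u<k =
    trans (adj-roles (role-indep u<k) (role-cliqueV k<k+k)) (dec-true (window? (toℕ u) k) (u<k , m≤n+m k (toℕ u)))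
  ... | clique {t} _ u≡k+t =
    trans (adj-roles (trans (cong role u≡k+t) (role-clique t)) (role-cliqueV k<k+k)) (dec-true (¬? (t ℕ.≟ k)) t≢k)
    where
    t≢k : t ≢ k
    t≢k t≡k = u≢hub (toℕ-injective (trans u≡k+t (trans (cong (k +_) t≡k) (sym (toℕ-cliqueV k<k+k)))))

  open WithUniversalVertex G hub hub-adj public

  window-top : k ≤ m → Window (m ∸ k) m
  window-top {m} k≤m =
    subst (m ∸ k <_) (m∸n+n≡m k≤m) (m<m+n (m ∸ k) 0<k) , ≤-reflexive (sym (m∸n+n≡m k≤m))

  ∸k<k : k ≤ m → m < k + k → m ∸ k < k
  ∸k<k {m} k≤m m<2k = +-cancelʳ-< k (m ∸ k) k (subst (_< k + k) (sym (m∸n+n≡m k≤m)) m<2k)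

  sees-differ : Window a s → ¬ Window a t → sees a s ≢ sees a t
  sees-differ {a} {s} {t} w ¬w eq =
    contradiction (trans (sym (dec-true (window? a s) w)) (trans eq (dec-false (window? a t) ¬w))) λ ()

  separating : s < t → t < k + k → Σ[ a ∈ ℕ ] a < k × sees a s ≢ sees a t
  separating {s} {t} s<t t<2k with s <? k | t ≤? s + k
  ... | yes s<k | yes t≤s+k = s , s<k , sees-differ (s<t , t≤s+k) (λ (s<s′ , _) → <-irrefl refl s<s′) ∘ sym
  ... | yes _   | no  t≰s+k =
    t ∸ k , ∸k<k k≤t t<2k , sees-differ (window-top k≤t) (λ (t∸k<s , _) → <-asym t∸k<s s<t∸k) ∘ sym
    where
    s+k<t : s + k < t
    s+k<t = ≰⇒> t≰s+k
    k≤t : k ≤ t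
    k≤t = ≤-trans (m≤n+m k s) (<⇒≤ s+k<t)
    s<t∸k : s < t ∸ k
    s<t∸k = m+n≤o⇒m≤o∸n (suc s) s+k<t
  ... | no  s≮k | _ =
    s ∸ k , ∸k<k k≤s (<-trans s<t t<2k) ,
    sees-differ (window-top k≤s) (λ (_ , t≤s) → <⇒≱ s<t (subst (t ≤_) (m∸n+n≡m k≤s) t≤s))
    where
    k≤s : k ≤ s
    k≤s = ≮⇒≥ s≮k

  sees-injective : s < k + k → t < k + k → (∀ a → a < k → sees a s ≡ sees a t) → s ≡ t
  sees-injective {s} {t} s<2k t<2k agree with <-cmp s t
  ... | tri≈ _ s≡t _ = s≡t
  ... | tri< s<t _ _ = let (a , a<k , differ) = separating s<t t<2k in contradiction (agree a a<k) differ
  ... | tri> _ _ t<s = let (a , a<k , differ) = separating t<s s<2k in contradiction (sym (agree a a<k)) differ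

  indepSet : Subset (3 * k)
  indepSet = tabulate (λ v → does (toℕ v <? k))

  χ-indepSet-indep : a < k → χ indepSet a ≡ 1
  χ-indepSet-indep {a} a<k =
    trans (χ-tabulate (λ m → does (m <? k)) a (indep<3k a<k)) (cong bit (dec-true (a <? k) a<k))

  χ-indepSet-clique : t < k + k → χ indepSet (k + t) ≡ 0
  χ-indepSet-clique {t} t<2k =
    trans (χ-tabulate (λ m → does (m <? k)) (k + t) (clique<3k t<2k))
          (cong bit (dec-false (k + t <? k) (m+n≮m k t)))

  ∈indepSet : ∀ {v} → toℕ v < k → v ∈ indepSet
  ∈indepSet {v} v<k = lookup⇒[]= v indepSet (trans (lookup∘tabulate _ v) (dec-true (toℕ v <? k) v<k))

  ∣W∣≡indep+clique : ∀ (W : Subset (3 * k)) → ∣ W ∣ ≡ ∑< k (χ W) + ∑< (k + k) (λ t → χ W (k + t))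
  ∣W∣≡indep+clique W =
    trans (∣p∣≡∑χ W) (trans (cong (λ n → ∑< n (χ W)) 3k≡k+2k) (∑<-split k (k + k) (χ W)))

  ∣indepSet∣≡k : ∣ indepSet ∣ ≡ k
  ∣indepSet∣≡k = begin
    ∣ indepSet ∣
      ≡⟨ ∣W∣≡indep+clique indepSet ⟩
    ∑< k (χ indepSet) + ∑< (k + k) (λ t → χ indepSet (k + t))
      ≡⟨ cong₂ _+_ (∑<-cong k (λ _ → χ-indepSet-indep)) (∑<-cong (k + k) (λ _ → χ-indepSet-clique)) ⟩
    ∑< k (λ _ → 1) + ∑< (k + k) (λ _ → 0)
      ≡⟨ cong₂ _+_ (∑<-ones k) (∑<-zeros (k + k)) ⟩
    k + 0
      ≡⟨ +-identityʳ k ⟩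
    k ∎
    where open ≡-Reasoning

  indepSet-resolving : Resolving G indepSet
  indepSet-resolving x y x≈y with label (toℕ x) (toℕ<n x) | label (toℕ y) (toℕ<n y)
  ... | indep x<k | _         = sameRep-∈ x≈y (∈indepSet x<k)
  ... | _         | indep y<k = sym (sameRep-∈ (sameRep-sym x≈y) (∈indepSet y<k))
  ... | clique {s} s<2k x≡k+s | clique {t} t<2k y≡k+t =
    toℕ-injective (trans x≡k+s (trans (cong (k +_) (sees-injective s<2k t<2k agree)) (sym y≡k+t)))
    where
    agree : ∀ a → a < k → sees a s ≡ sees a t
    agree a a<k = begin
      sees a s          ≡⟨ adj-roles (trans (cong role x≡k+s) (role-clique s)) role-w ⟨
      adj G x w         ≡⟨ sameRep⇒adj≡ x≈y (∈indepSet w<k) (clique≢w x≡k+s) (clique≢w y≡k+t) ⟩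
      adj G y w         ≡⟨ adj-roles (trans (cong role y≡k+t) (role-clique t)) role-w ⟩
      sees a t          ∎
      where
      open ≡-Reasoning
      w : Fin (3 * k)
      w = fromℕ< (indep<3k a<k)
      w<k : toℕ w < k
      w<k = subst (_< k) (sym (toℕ-fromℕ< (indep<3k a<k))) a<k
      role-w : role (toℕ w) ≡ indep a
      role-w = trans (cong role (toℕ-fromℕ< (indep<3k a<k))) (role-indep a<k)
      clique≢w : ∀ {v r} → toℕ v ≡ k + r → v ≢ w
      clique≢w v≡k+r refl = <⇒≱ w<k (subst (k ≤_) (sym v≡k+r) (m≤m+n k _))

  next : ℕ → ℕ
  next t = suc t % (k + k)

  next<k+k : ∀ t → next t < k + k
  next<k+k t = m%n<n (suc t) (k + k)

  cut : ℕ → ℕ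
  cut t = t % k

  window-step : t ≢ a → t ≢ a + k → Window a t ⇔ Window a (suc t)
  window-step t≢a t≢a+k = mk⇔
    (λ (a<t , t≤a+k) → m<n⇒m<1+n a<t , ≤∧≢⇒< t≤a+k t≢a+k)
    (λ (a<1+t , 1+t≤a+k) → ≤∧≢⇒< (s≤s⁻¹ a<1+t) (t≢a ∘ sym) , <⇒≤ 1+t≤a+k)

  window-wrap : suc t ≡ k + k → a < k → Window a t → t ≡ a + k
  window-wrap {t} {a} 1+t≡2k a<k (_ , t≤a+k) =
    ≤-antisym t≤a+k (s≤s⁻¹ (subst (suc a + k ≤_) (sym 1+t≡2k) (+-monoˡ-≤ k a<k)))

  ≢cut⇒≢ends : a < k → a ≢ cut t → t ≢ a × t ≢ a + k
  ≢cut⇒≢ends {a} a<k a≢cut =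
    (λ { refl → a≢cut (sym (m<n⇒m%n≡m a<k)) }) ,
    (λ { refl → a≢cut (sym (trans ([m+n]%n≡m%n a k) (m<n⇒m%n≡m a<k))) })

  sees-next : a < k → t < k + k → a ≢ cut t → sees a t ≡ sees a (next t)
  sees-next {a} {t} a<k t<2k a≢cut with m≤n⇒m<n∨m≡n t<2k | ≢cut⇒≢ends a<k a≢cut
  ... | inj₁ 1+t<2k | t≢a , t≢a+k = begin
    sees a t        ≡⟨ does-⇔ (window-step t≢a t≢a+k) (window? a t) (window? a (suc t)) ⟩
    sees a (suc t)  ≡⟨ cong (sees a) (m<n⇒m%n≡m 1+t<2k) ⟨
    sees a (next t) ∎
    where open ≡-Reasoning
  ... | inj₂ 1+t≡2k | _ , t≢a+k = begin
    sees a t        ≡⟨ dec-false (window? a t) (t≢a+k ∘ window-wrap 1+t≡2k a<k) ⟩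
    false           ≡⟨ dec-false (window? a 0) (λ ()) ⟨
    sees a 0        ≡⟨ cong (sees a) (trans (cong (_% (k + k)) 1+t≡2k) (n%n≡0 (k + k))) ⟨
    sees a (next t) ∎
    where open ≡-Reasoning

  clique-resolved : Resolving G W → s < k + k → t < k + k → χ W (k + s) ≡ 0 → χ W (k + t) ≡ 0 →
                    (∀ a → a < k → χ W a ≡ 1 → sees a s ≡ sees a t) → s ≡ t
  clique-resolved {W} {s} {t} resolving s<2k t<2k s∉W t∉W agree =
    +-cancelˡ-≡ k s t (trans (sym (toℕ-cliqueV s<2k)) (trans (cong toℕ cs≡ct) (toℕ-cliqueV t<2k)))
    where
    cs ct : Fin (3 * k)
    cs = cliqueV s s<2k
    ct = cliqueV t t<2k
    cliqueV≢ : ∀ {r} (r<2k : r < k + k) → χ W (k + r) ≡ 0 → ∀ {w} → w ∈ W → cliqueV r r<2k ≢ w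
    cliqueV≢ r<2k r∉W w∈W refl = ≢-by-χ {p = W} (χ-∈ w∈W) r∉W (toℕ-cliqueV r<2k)
    adj≡ : ∀ {w} → w ∈ W → adj G cs w ≡ adj G ct w
    adj≡ {w} w∈W with label (toℕ w) (toℕ<n w)
    ... | indep w<k = begin
      adj G cs w     ≡⟨ adj-roles (role-cliqueV s<2k) (role-indep w<k) ⟩
      sees (toℕ w) s ≡⟨ agree (toℕ w) w<k (χ-∈ w∈W) ⟩
      sees (toℕ w) t ≡⟨ adj-roles (role-cliqueV t<2k) (role-indep w<k) ⟨
      adj G ct w     ∎
      where open ≡-Reasoning
    ... | clique {r} _ w≡k+r = trans (clique-adj s<2k s∉W) (sym (clique-adj t<2k t∉W))
      where
      clique-adj : ∀ {q} (q<2k : q < k + k) → χ W (k + q) ≡ 0 → adj G (cliqueV q q<2k) w ≡ true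
      clique-adj {q} q<2k q∉W =
        trans (adj-roles (role-cliqueV q<2k) (trans (cong role w≡k+r) (role-clique r)))
              (dec-true (¬? (q ℕ.≟ r)) λ q≡r →
                 ≢-by-χ {p = W} (χ-∈ w∈W) q∉W (trans w≡k+r (cong (k +_) (sym q≡r))))
    cs≡ct : cs ≡ ct
    cs≡ct = resolving cs ct (adj≡⇒sameRep λ w w∈W →
      cliqueV≢ s<2k s∉W w∈W , cliqueV≢ t<2k t∉W w∈W , adj≡ w∈W)

  -- The number of elements of W that can separate c_t from c_{next t}.
  cover : Subset (3 * k) → ℕ → ℕ
  cover W t = χ W (k + t) + χ W (k + next t) + χ W (cut t)

  ∑cover≡2∣W∣ : ∀ (W : Subset (3 * k)) → ∑< (k + k) (cover W) ≡ ∣ W ∣ + ∣ W ∣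
  ∑cover≡2∣W∣ W = begin
    ∑< (k + k) (cover W)
      ≡⟨ ∑<-distrib-+ (k + k) _ _ ⟩
    ∑< (k + k) (λ t → χ W (k + t) + χ W (k + next t)) + ∑< (k + k) (λ t → χ W (cut t))
      ≡⟨ cong₂ _+_ (∑<-distrib-+ (k + k) _ _) (∑<-mod-double k (χ W)) ⟩
    C + ∑< (k + k) (λ t → χ W (k + next t)) + (I + I)
      ≡⟨ cong (λ c → C + c + (I + I)) (∑<-rotate (k + k) _) ⟩
    C + C + (I + I)
      ≡⟨ interchange C C I I ⟩
    C + I + (C + I)
      ≡⟨ cong₂ _+_ (+-comm C I) (+-comm C I) ⟩
    I + C + (I + C)
      ≡⟨ cong₂ _+_ (∣W∣≡indep+clique W) (∣W∣≡indep+clique W) ⟨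
    ∣ W ∣ + ∣ W ∣ ∎
    where
    open ≡-Reasoning
    I C : ℕ
    I = ∑< k (χ W)
    C = ∑< (k + k) (λ t → χ W (k + t))

  covered : Resolving G W → t < k + k → 1 ≤ cover W t
  covered {W} {t} resolving t<2k with χ W (k + t) in t∉W | χ W (k + next t) in next∉W | χ W (cut t) in cut∉W
  ... | suc _ | _     | _     = s≤s z≤n
  ... | zero  | suc _ | _     = s≤s z≤n
  ... | zero  | zero  | suc _ = s≤s z≤n
  ... | zero  | zero  | zero  =
    contradiction (clique-resolved resolving t<2k (next<k+k t) t∉W next∉W agree)
                  (suc-%-≢ (k + k) (<-trans (s<s z<s) 2<k+k) t<2k ∘ sym)
    where
    agree : ∀ a → a < k → χ W a ≡ 1 → sees a t ≡ sees a (next t)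
    agree a a<k a∈W = sees-next a<k t<2k (≢-by-χ {p = W} a∈W cut∉W)

  resolving-size : Resolving G W → k ≤ ∣ W ∣
  resolving-size {W} resolving = ≮⇒≥ λ ∣W∣<k → <⇒≱ (+-mono-< ∣W∣<k ∣W∣<k) k+k≤2∣W∣
    where
    k+k≤2∣W∣ : k + k ≤ ∣ W ∣ + ∣ W ∣
    k+k≤2∣W∣ =
      subst₂ _≤_ (∑<-ones (k + k)) (∑cover≡2∣W∣ W) (∑<-mono-≤ (k + k) (λ _ → covered resolving))

  module _ {W} (resolving : Resolving G W) (∣W∣≡k : ∣ W ∣ ≡ k) where

    covered-once : t < k + k → cover W t ≡ 1
    covered-once {t} t<2k = sym (∑<-mono-≤-tight (k + k) (λ _ → covered resolving) ∑cover≤k+k t t<2k)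
      where
      ∑cover≤k+k : ∑< (k + k) (cover W) ≤ ∑< (k + k) (λ _ → 1)
      ∑cover≤k+k =
        ≤-reflexive (trans (∑cover≡2∣W∣ W) (trans (cong₂ _+_ ∣W∣≡k ∣W∣≡k) (sym (∑<-ones (k + k)))))

    -- If c_{next t} were in W, it would be the only element of W covering the pairs at t and at next t,
    -- so W would not tell c_t from c_{next (next t)}.
    next∉W : t < k + k → χ W (k + next t) ≡ 0
    next∉W {t} t<2k with χ W (k + next t) in next∈W | χ≤1 W (k + next t)
    ... | zero        | _ = refl
    ... | suc (suc _) | s≤s ()
    ... | suc zero    | _ =
      contradiction (clique-resolved resolving t<2k (next<k+k (next t)) t∉W next²∉W agree)
                    (suc-%-suc-%-≢ (k + k) 2<k+k t<2k ∘ sym)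
      where
      pair-t : χ W (k + t) ≡ 0 × χ W (cut t) ≡ 0
      pair-t = x+1+z≡1⇒ _ _ (subst (λ c → χ W (k + t) + c + χ W (cut t) ≡ 1) next∈W (covered-once t<2k))
      pair-next : χ W (k + next (next t)) ≡ 0 × χ W (cut (next t)) ≡ 0
      pair-next = 1+y+z≡1⇒ _ _ (subst (λ c → c + χ W (k + next (next t)) + χ W (cut (next t)) ≡ 1) next∈W
                                       (covered-once (next<k+k t)))
      t∉W : χ W (k + t) ≡ 0
      t∉W = proj₁ pair-t
      next²∉W : χ W (k + next (next t)) ≡ 0
      next²∉W = proj₁ pair-next
      agree : ∀ a → a < k → χ W a ≡ 1 → sees a t ≡ sees a (next (next t))
      agree a a<k a∈W = trans (sees-next a<k t<2k (≢-by-χ {p = W} a∈W (proj₂ pair-t)))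
                              (sees-next a<k (next<k+k t) (≢-by-χ {p = W} a∈W (proj₂ pair-next)))

    clique∉W : t < k + k → χ W (k + t) ≡ 0
    clique∉W {t} t<2k = sym (∑<-mono-≤-tight (k + k) (λ _ _ → z≤n) (≤-reflexive ∑clique≡0) t t<2k)
      where
      ∑clique≡0 : ∑< (k + k) (λ t → χ W (k + t)) ≡ ∑< (k + k) (λ _ → 0)
      ∑clique≡0 = trans (sym (∑<-rotate (k + k) _)) (∑<-cong (k + k) (λ _ → next∉W))

    indep∈W : a < k → χ W a ≡ 1
    indep∈W {a} a<k = ∑<-mono-≤-tight k (λ m _ → χ≤1 W m) (≤-reflexive ∑indep≡k) a a<k
      where
      ∑indep≡k : ∑< k (λ _ → 1) ≡ ∑< k (χ W)
      ∑indep≡k = begin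
        ∑< k (λ _ → 1)                               ≡⟨ ∑<-ones k ⟩
        k                                            ≡⟨ ∣W∣≡k ⟨
        ∣ W ∣                                        ≡⟨ ∣W∣≡indep+clique W ⟩
        ∑< k (χ W) + ∑< (k + k) (λ t → χ W (k + t))  ≡⟨ cong (∑< k (χ W) +_) (∑<-cong (k + k) (λ _ → clique∉W)) ⟩
        ∑< k (χ W) + ∑< (k + k) (λ _ → 0)            ≡⟨ cong (∑< k (χ W) +_) (∑<-zeros (k + k)) ⟩
        ∑< k (χ W) + 0                               ≡⟨ +-identityʳ _ ⟩
        ∑< k (χ W)                                   ∎
        where open ≡-Reasoning

    ≡indepSet : W ≡ indepSet
    ≡indepSet = χ-injective W indepSet χ≗χ
      where
      χ≗χ : ∀ m → m < 3 * k → χ W m ≡ χ indepSet m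
      χ≗χ m m<3k with label m m<3k
      ... | indep m<k           = trans (indep∈W m<k) (sym (χ-indepSet-indep m<k))
      ... | clique t<2k refl    = trans (clique∉W t<2k) (sym (χ-indepSet-clique t<2k))

  indepSet-basis : MetricBasis G indepSet
  indepSet-basis = indepSet-resolving , λ W resolving →
    subst (_≤ ∣ W ∣) (sym ∣indepSet∣≡k) (resolving-size resolving)

  basis-unique : ∀ W → MetricBasis G W → W ≡ indepSet
  basis-unique W (resolving , minimal) =
    ≡indepSet resolving (≤-antisym (subst (∣ W ∣ ≤_) ∣indepSet∣≡k (minimal indepSet indepSet-resolving))
                                   (resolving-size resolving))

theorem9 : (k : ℕ) → 2 ≤ k → Σ (Graph (3 * k)) λ G → Connected G × MetricDimension G k × UniqueBasis G
theorem9 k 2≤k =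
  G , connected , (indepSet , indepSet-basis , ∣indepSet∣≡k) , (indepSet , indepSet-basis , basis-unique)
  where open Construction k 2≤k
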